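{- Let $\mathrm{sort}$ be a sort function satisfying the characteristic property. For every type $T$, every relation $\leq$ on $T$ and every $xs : \mathrm{list}\,T$, the list $\mathrm{sort}_\leq\,xs$ is a permutation of $xs$.
   Context: A list $s_1$ is a permutation of $s_2$ if every element occurs the same number of times in $s_1$ and in $s_2$. Lists: $[]$ is the empty list, $x :: s$ is cons, $[x]$ is the singleton list, $\mathbin{+\!\!+}$ is concatenation. A "relation" $\leq$ on a type $T$ is a function $T \to T \to \mathrm{bool}$. The merge of two lists w.r.t. $\leq$ is defined by $[] \mathbin{\land\hspace{ -.45em}\land}_\leq ys = ys$, $xs \mathbin{\land\hspace{ -.45em}\land}_\leq [] = xs$, and $(x :: xs) \mathbin{\land\hspace{ -.45em}\land}_\leq (y :: ys) = x :: (xs \mathbin{\land\hspace{ -.45em}\land}_\leq (y :: ys))$ if $x \leq y$, and $= y :: ((x :: xs) \mathbin{\land\hspace{ -.45em}\land}_\leq ys)$ otherwise. A sort function $\mathrm{sort}$ assigns to every type $T$ and relation $\leq$ on $T$ a function $\mathrm{sort}_\leq : \mathrm{list}\,T \to \mathrm{list}\,T$. It satisfies the characteristic property if there is a polymorphic function $\mathrm{asort}$ of type $\forall (T\,R : \mathcal{U}), (R \to R \to R) \to (T \to R) \to R \to \mathrm{list}\,T \to R$ such that: (1) for all $T$, $\leq$, $xs$: $\mathrm{asort}\,(\mathbin{\land\hspace{ -.45em}\land}_\leq)\,(\lambda x.[x])\,[]\,xs = \mathrm{sort}_\leq\,xs$; (2) for all $T$, $xs$: $\mathrm{asort}\,(\mathbin{+\!\!+})\,(\lambda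 x.[x])\,[]\,xs = xs$; (3) $\mathrm{asort}$ is relationally parametric: for all types $T_1,T_2$ and relation $\sim_T \subseteq T_1 \times T_2$, all types $R_1,R_2$ and relation $\sim_R \subseteq R_1\times R_2$, all $m_i : R_i \to R_i \to R_i$ with $a_1 \sim_R a_2 \wedge b_1 \sim_R b_2 \Rightarrow m_1\,a_1\,b_1 \sim_R m_2\,a_2\,b_2$, all $s_i : T_i \to R_i$ with $x_1 \sim_T x_2 \Rightarrow s_1\,x_1 \sim_R s_2\,x_2$, all $e_i : R_i$ with $e_1 \sim_R e_2$, and all lists $xs_1 : \mathrm{list}\,T_1$, $xs_2 : \mathrm{list}\,T_2$ of equal length that are pointwise $\sim_T$-related, we have $\mathrm{asort}\,m_1\,s_1\,e_1\,xs_1 \sim_R \mathrm{asort}\,m_2\,s_2\,e_2\,xs_2$. -}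

module Defs where

open import Data.Bool using (Bool; if_then_else_)
open import Data.List using (List; []; _∷_; _++_; [_])
open import Data.List.Relation.Binary.Pointwise using (Pointwise)
open import Data.Product using (Σ; _×_)
open import Relation.Binary.PropositionalEquality using (_≡_)

Rel : Set → Set
Rel T = T → T → Bool

merge : {T : Set} → Rel T → List T → List T → List T
merge leq []       ys       = ys
merge leq (x ∷ xs) []       = x ∷ xs
merge leq (x ∷ xs) (y ∷ ys) =
  if leq x y then x ∷ merge leq xs (y ∷ ys)
             else y ∷ merge leq (x ∷ xs) ys

SortFun : Set₁
SortFun = {T : Set} → Rel T → List T → List T

ASortType : Set₁
ASortType = (T R : Set) → (R → R → R) → (T → R) → R → List T → R

Parametric : ASortType → Set₁
Parametric asort =
  (T₁ T₂ : Set) (_∼T_ : T₁ → T₂ → Set)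
  (R₁ R₂ : Set) (_∼R_ : R₁ → R₂ → Set)
  (m₁ : R₁ → R₁ → R₁) (m₂ : R₂ → R₂ → R₂) →
  (∀ {a₁ a₂ b₁ b₂} → a₁ ∼R a₂ → b₁ ∼R b₂ → m₁ a₁ b₁ ∼R m₂ a₂ b₂) →
  (s₁ : T₁ → R₁) (s₂ : T₂ → R₂) →
  (∀ {x₁ x₂} → x₁ ∼T x₂ → s₁ x₁ ∼R s₂ x₂) →
  (e₁ : R₁) (e₂ : R₂) → e₁ ∼R e₂ →
  (xs₁ : List T₁) (xs₂ : List T₂) → Pointwise _∼T_ xs₁ xs₂ →
  asort T₁ R₁ m₁ s₁ e₁ xs₁ ∼R asort T₂ R₂ m₂ s₂ e₂ xs₂

CharacteristicProperty : SortFun → Set₁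
CharacteristicProperty sort =
  Σ ASortType λ asort →
    ((T : Set) (leq : Rel T) (xs : List T) →
       asort T (List T) (merge leq) [_] [] xs ≡ sort leq xs)
    × ((T : Set) (xs : List T) →
       asort T (List T) _++_ [_] [] xs ≡ xs)
    × Parametric asort

-- Apply parametricity of asort to the relation "is a permutation of" between its merge
-- instance and its concatenation instance: merging is a permutation of appending and
-- appending preserves permutations, so the two runs stay related, and they compute
-- sort xs and xs respectively.
module Submission where

open import Defs
open import Data.Bool using (true; false)
open import Data.List using (List; []; _∷_; _++_; [_])
open import Data.List.Properties using (++-identityʳ)
open import Data.List.Relation.Binary.Permutation.Propositional
  using (_↭_; prep; trans; ↭-sym; ↭-refl; ↭-reflexive)
open import Data.List.Relation.Binary.Permutation.Propositional.Properties using (++⁺; shift)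
import Data.List.Relation.Binary.Pointwise.Properties as Pointwise
open import Data.Product using (_,_)
open import Relation.Binary.PropositionalEquality using (_≡_; refl; sym; subst₂)

merge-↭ : {T : Set} (leq : Rel T) (xs ys : List T) → merge leq xs ys ↭ xs ++ ys
merge-↭ leq []       ys = ↭-refl
merge-↭ leq (x ∷ xs) ys = merge-cons-↭ ys
  where
  merge-cons-↭ : (ys : List _) → merge leq (x ∷ xs) ys ↭ x ∷ xs ++ ys
  merge-cons-↭ []       = ↭-reflexive (sym (++-identityʳ (x ∷ xs)))
  merge-cons-↭ (y ∷ ys) with leq x y
  ... | true  = prep x (merge-↭ leq xs (y ∷ ys))
  ... | false = trans (prep y (merge-cons-↭ ys)) (↭-sym (shift y (x ∷ xs) ys))

merge-↭-++ : {T : Set} (leq : Rel T) {as bs cs ds : List T} →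
  as ↭ bs → cs ↭ ds → merge leq as cs ↭ bs ++ ds
merge-↭-++ leq {as} {cs = cs} as↭bs cs↭ds = trans (merge-↭ leq as cs) (++⁺ as↭bs cs↭ds)

lemma3p7 : (sort : SortFun) → CharacteristicProperty sort →
    (T : Set) (leq : Rel T) (xs : List T) → sort leq xs ↭ xs
lemma3p7 sort (asort , asort-merge , asort-++ , parametric) T leq xs =
  subst₂ _↭_ (asort-merge T leq xs) (asort-++ T xs) merge-run↭append-run
  where
  merge-run↭append-run : asort T (List T) (merge leq) [_] [] xs ↭ asort T (List T) _++_ [_] [] xs
  merge-run↭append-run =
    parametric T T _≡_ (List T) (List T) _↭_ (merge leq) _++_ (merge-↭-++ leq)
      [_] [_] (λ { refl → ↭-refl }) [] [] ↭-refl xs xs (Pointwise.refl refl)
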